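{- Let $n$ and $a$ be integers such that $n>3$, $|a|\ge 1$ and $a\notin\{1,n-1\}$. Let $\overrightarrow{G}=\overrightarrow{C}(n;1,a)$ and let $G$ be its underlying undirected graph. Then $$\beta_b(\overrightarrow{G}) \ge \max\{\beta_b(G), \mathrm{diam}(\overrightarrow{G})\}.$$
   Context: For integers $n\ge 3$ and $b_1,\dots,b_k$, the oriented circulant graph $\overrightarrow{C}(n;b_1,\dots,b_k)$ has vertex set $\{v_0,\dots,v_{n-1}\}$ and arc set $\{v_iv_{i+b_j}\}$, subscripts modulo $n$ (negative $b_j$ allowed). In the oriented graph, $d(u,v)$ is the length of a shortest directed path from $u$ to $v$, $e(v)=\max_u d(v,u)$, and $\mathrm{diam}$ is the maximum eccentricity; an independent broadcast on $\overrightarrow{G}$ is $f:V\to\{0,\dots,\mathrm{diam}(\overrightarrow{G})\}$ with $f(v)\le e(v)$ for all $v$ and $d(u,v)>f(u)$ for all distinct $u,v$ with $f(u),f(v)>0$. For an undirected graph $G$, with usual distance $d_G$, eccentricity $e_G$ and diameter $\mathrm{diam}(G)$, an independent broadcast is $f:V(G)\to\{0,\dots,\mathrm{diam}(G)\}$ with $f(v)\le e_G(v)$ for all $v$ and $d_G(u,v)>\max\{f(u),f(v)\}$ for all distinct $u,v$ with $f(u),f(v)>0$. In both cases the cost is $\sigma(f)=\sum_v f(v)$ and $\beta_b$ is the maximum cost of an independent broadcast. -}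

module Defs where

open import Data.Bool using (Bool; true; false; _∨_; _∧_; if_then_else_)
open import Data.Nat using (ℕ; zero; suc; _+_; _∸_; _⊔_; _≤_; _<_; NonZero)
open import Data.Fin using (Fin; toℕ; fromℕ<; _≟_)
open import Data.List using (List; map; foldr; allFin)
open import Data.Bool.ListAction using (any)
open import Data.Nat.ListAction using (sum)
open import Data.Integer using (ℤ; +_; _%ℕ_)
import Data.Integer as ℤ
open import Data.Integer.DivMod using (n%ℕd<d)
open import Data.Product using (Σ; _×_; ∃)
open import Relation.Nullary using (¬_; does)
open import Relation.Binary.PropositionalEquality using (_≡_)

DiGraph : ℕ → Set
DiGraph n = Fin n → Fin n → Bool

underlying : ∀ {n} → DiGraph n → DiGraph n
underlying adj u v = adj u v ∨ adj v u

reach : ∀ {n} → DiGraph n → ℕ → Fin n → Fin n → Bool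
reach adj zero    u v = does (u ≟ v)
reach {n} adj (suc k) u v =
  reach adj k u v ∨ any (λ w → adj u w ∧ reach adj k w v) (allFin n)

-- least k < bound with p k = true, or bound if there is none
firstTrue : ℕ → (ℕ → Bool) → ℕ
firstTrue zero      p = zero
firstTrue (suc b)   p = if p zero then zero else suc (firstTrue b (λ k → p (suc k)))

-- Distance d(u,v): length of a shortest directed walk from u to v.
-- (Every graph used below is strongly connected, so d(u,v) ≤ n - 1 and
--  the search bound n is never reached.)
dist : ∀ {n} → DiGraph n → Fin n → Fin n → ℕ
dist {n} adj u v = firstTrue n (λ k → reach adj k u v)

maxList : List ℕ → ℕ
maxList = foldr _⊔_ 0

ecc : ∀ {n} → DiGraph n → Fin n → ℕ
ecc {n} adj v = maxList (map (dist adj v) (allFin n))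

diam : ∀ {n} → DiGraph n → ℕ
diam {n} adj = maxList (map (ecc adj) (allFin n))

cost : ∀ {n} → (Fin n → ℕ) → ℕ
cost {n} f = sum (map f (allFin n))

IndBroadcastDir : ∀ {n} → DiGraph n → (Fin n → ℕ) → Set
IndBroadcastDir adj f =
  (∀ v → f v ≤ diam adj) ×
  (∀ v → f v ≤ ecc adj v) ×
  (∀ u v → ¬ (u ≡ v) → 0 < f u → 0 < f v → f u < dist adj u v)

IndBroadcastUndir : ∀ {n} → DiGraph n → (Fin n → ℕ) → Set
IndBroadcastUndir adj f =
  (∀ v → f v ≤ diam adj) ×
  (∀ v → f v ≤ ecc adj v) ×
  (∀ u v → ¬ (u ≡ v) → 0 < f u → 0 < f v → (f u ⊔ f v) < dist adj u v)

shift : (n : ℕ) .{{_ : NonZero n}} → ℤ → Fin n → Fin n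
shift n b i = fromℕ< (n%ℕd<d (+ toℕ i ℤ.+ b) n)

circulant1a : (n : ℕ) .{{_ : NonZero n}} → ℤ → DiGraph n
circulant1a n a u v = does (v ≟ shift n (+ 1) u) ∨ does (v ≟ shift n a u)

{-# OPTIONS --safe #-}
-- Adding the reverse arcs can only shorten distances, so every distance, eccentricity and the
-- diameter of the underlying graph G is bounded by the corresponding quantity of the oriented
-- graph. Hence an independent broadcast of G, whose condition d(u,v) > max{f(u),f(v)} is the
-- stronger one, is already an independent broadcast of the oriented graph. For the second
-- bound, let a vertex x of maximum eccentricity broadcast at strength e(x) = diam and all other
-- vertices stay silent.
module Submission where

open import Defs
open import Data.Nat using (ℕ; _<_; _≤_; NonZero)
open import Data.Integer using (ℤ; +_; ∣_∣)
open import Data.Fin using (Fin)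
open import Data.Product using (Σ; _×_)
open import Relation.Nullary using (¬_)
open import Relation.Binary.PropositionalEquality using (_≡_)

open import Data.Nat using (zero; suc; z≤n; s≤s)
open import Data.Nat.Properties
  using (≤-refl; ≤-trans; m≤m+n; m≤n+m; m≤m⊔n; m≤n⊔m; ⊔-mono-≤; ⊔-sel)
open import Data.Nat.ListAction using (sum)
open import Data.Bool using (Bool; true; false; T; _∧_)
open import Data.Bool.Properties using (T-∨; T-∧)
open import Data.Empty using (⊥-elim)
open import Data.Fin using (_≟_)
open import Data.List using ([]; _∷_; map; allFin)
open import Data.List.Relation.Unary.Any using (here; there)
import Data.List.Relation.Unary.Any as Any
open import Data.List.Relation.Unary.Any.Properties using (any⁺; any⁻)
open import Data.List.Membership.Propositional using (_∈_)
open import Data.List.Membership.Propositional.Properties using (∈-allFin; ∈-map⁺; ∈-map⁻)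
open import Data.Product using (_,_)
open import Data.Sum using (_⊎_; inj₁; inj₂)
open import Function.Bundles using (Equivalence)
open import Relation.Nullary using (yes; no)
open import Relation.Binary.PropositionalEquality using (refl; sym; trans; subst)

open Equivalence using (to; from)

infix 4 _⊆ᴳ_

_⊆ᴳ_ : ∀ {n} → DiGraph n → DiGraph n → Set
adj ⊆ᴳ adj′ = ∀ {u v} → T (adj u v) → T (adj′ u v)

⊆ᴳ-underlying : ∀ {n} (adj : DiGraph n) → adj ⊆ᴳ underlying adj
⊆ᴳ-underlying adj uv = from T-∨ (inj₁ uv)

reach-mono-⊆ᴳ : ∀ {n} {adj adj′ : DiGraph n} → adj ⊆ᴳ adj′ →
  ∀ k {u v} → T (reach adj k u v) → T (reach adj′ k u v)
reach-mono-⊆ᴳ sub zero    r = r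
reach-mono-⊆ᴳ {n} {adj} {adj′} sub (suc k) {u} {v} r with to T-∨ r
... | inj₁ short = from T-∨ (inj₁ (reach-mono-⊆ᴳ sub k short))
... | inj₂ step  = from T-∨ (inj₂ (any⁺ _ (Any.map viaArc (any⁻ _ (allFin n) step))))
  where
  viaArc : ∀ {w} → T (adj u w ∧ reach adj k w v) → T (adj′ u w ∧ reach adj′ k w v)
  viaArc uwv with to T-∧ uwv
  ... | uw , wv = from T-∧ (sub uw , reach-mono-⊆ᴳ sub k wv)

firstTrue-antimono : ∀ b {p q : ℕ → Bool} → (∀ k → T (p k) → T (q k)) →
  firstTrue b q ≤ firstTrue b p
firstTrue-antimono zero    p⇒q = z≤n
firstTrue-antimono (suc b) {p} {q} p⇒q with p zero in p0 | q zero in q0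
... | _     | true  = z≤n
... | true  | false = ⊥-elim (subst T q0 (p⇒q zero (subst T (sym p0) _)))
... | false | false = s≤s (firstTrue-antimono b (λ k → p⇒q (suc k)))

maxList-mono : ∀ {A : Set} {h h′ : A → ℕ} → (∀ x → h x ≤ h′ x) →
  ∀ xs → maxList (map h xs) ≤ maxList (map h′ xs)
maxList-mono h≤h′ []       = z≤n
maxList-mono h≤h′ (x ∷ xs) = ⊔-mono-≤ (h≤h′ x) (maxList-mono h≤h′ xs)

∈⇒≤maxList : ∀ {m ms} → m ∈ ms → m ≤ maxList ms
∈⇒≤maxList (here refl) = m≤m⊔n _ _
∈⇒≤maxList {ms = m ∷ ms} (there p) = ≤-trans (∈⇒≤maxList p) (m≤n⊔m m (maxList ms))

maxList-sel : ∀ ms → maxList ms ≡ 0 ⊎ maxList ms ∈ ms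
maxList-sel []       = inj₁ refl
maxList-sel (m ∷ ms) with ⊔-sel m (maxList ms)
... | inj₁ max≡m = inj₂ (here max≡m)
... | inj₂ max≡rest with maxList-sel ms
...   | inj₁ rest≡0 = inj₁ (trans max≡rest rest≡0)
...   | inj₂ rest∈  = inj₂ (there (subst (_∈ ms) (sym max≡rest) rest∈))

∈⇒≤sum : ∀ {m ms} → m ∈ ms → m ≤ sum ms
∈⇒≤sum (here refl) = m≤m+n _ _
∈⇒≤sum {ms = m ∷ ms} (there p) = ≤-trans (∈⇒≤sum p) (m≤n+m (sum ms) m)

module Antimono-⊆ᴳ {n} {adj adj′ : DiGraph n} (sub : adj ⊆ᴳ adj′) where

  dist-antimono-⊆ᴳ : ∀ u v → dist adj′ u v ≤ dist adj u v
  dist-antimono-⊆ᴳ u v = firstTrue-antimono n (λ k → reach-mono-⊆ᴳ sub k)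

  ecc-antimono-⊆ᴳ : ∀ v → ecc adj′ v ≤ ecc adj v
  ecc-antimono-⊆ᴳ v = maxList-mono (dist-antimono-⊆ᴳ v) (allFin n)

  diam-antimono-⊆ᴳ : diam adj′ ≤ diam adj
  diam-antimono-⊆ᴳ = maxList-mono ecc-antimono-⊆ᴳ (allFin n)

ecc≤diam : ∀ {n} (adj : DiGraph n) v → ecc adj v ≤ diam adj
ecc≤diam adj v = ∈⇒≤maxList (∈-map⁺ (ecc adj) (∈-allFin v))

IndBroadcastUndir⇒IndBroadcastDir : ∀ {n} {adj : DiGraph n} {f : Fin n → ℕ} →
  IndBroadcastUndir (underlying adj) f → IndBroadcastDir adj f
IndBroadcastUndir⇒IndBroadcastDir {adj = adj} {f} (≤diam , ≤ecc , indep) =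
  (λ v → ≤-trans (≤diam v) diam-antimono-⊆ᴳ) ,
  (λ v → ≤-trans (≤ecc v) (ecc-antimono-⊆ᴳ v)) ,
  λ u v u≢v 0<fu 0<fv → ≤-trans (s≤s (m≤m⊔n (f u) (f v)))
    (≤-trans (indep u v u≢v 0<fu 0<fv) (dist-antimono-⊆ᴳ u v))
  where open Antimono-⊆ᴳ (⊆ᴳ-underlying adj)

point : ∀ {n} → Fin n → ℕ → Fin n → ℕ
point x k w with w ≟ x
... | yes _ = k
... | no  _ = 0

point-at : ∀ {n} (x : Fin n) k → point x k x ≡ k
point-at x k with x ≟ x
... | yes _  = refl
... | no x≢x = ⊥-elim (x≢x refl)

k≤cost-point : ∀ {n} (x : Fin n) k → k ≤ cost (point x k)
k≤cost-point x k =
  subst (_≤ cost (point x k)) (point-at x k) (∈⇒≤sum (∈-map⁺ (point x k) (∈-allFin x)))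

point-indBroadcastDir : ∀ {n} (adj : DiGraph n) x {k} → k ≤ ecc adj x →
  IndBroadcastDir adj (point x k)
point-indBroadcastDir adj x {k} k≤ecc = ≤diam , ≤ecc , indep
  where
  ≤ecc : ∀ v → point x k v ≤ ecc adj v
  ≤ecc v with v ≟ x
  ... | yes refl = k≤ecc
  ... | no  _    = z≤n
  ≤diam : ∀ v → point x k v ≤ diam adj
  ≤diam v = ≤-trans (≤ecc v) (ecc≤diam adj v)
  indep : ∀ u v → ¬ u ≡ v → 0 < point x k u → 0 < point x k v → point x k u < dist adj u v
  indep u v u≢v _ _ with u ≟ x | v ≟ x
  indep u v u≢v _  _  | yes refl | yes refl = ⊥-elim (u≢v refl)
  indep u v u≢v () _  | no _     | _
  indep u v u≢v _  () | yes _    | no _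

diam-indBroadcastDir : ∀ {n} (adj : DiGraph n) →
  Σ (Fin n → ℕ) (λ f → IndBroadcastDir adj f × diam adj ≤ cost f)
diam-indBroadcastDir {n} adj with maxList-sel (map (ecc adj) (allFin n))
... | inj₁ diam≡0 =
  (λ _ → 0) , ((λ _ → z≤n) , (λ _ → z≤n) , λ _ _ _ ()) , subst (_≤ _) (sym diam≡0) z≤n
... | inj₂ diam∈ with ∈-map⁻ (ecc adj) diam∈
...   | x , _ , diam≡ecc =
  point x (ecc adj x) ,
  point-indBroadcastDir adj x ≤-refl ,
  subst (_≤ cost (point x (ecc adj x))) (sym diam≡ecc) (k≤cost-point x (ecc adj x))

proposition1 : (n : ℕ) .{{_ : NonZero n}} (a : ℤ) → 3 < n → 1 ≤ ∣ a ∣ →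
    ¬ (a ≡ + 1) → ¬ (a ≡ + (n Data.Nat.∸ 1)) →
    ((g : Fin n → ℕ) → IndBroadcastUndir (underlying (circulant1a n a)) g →
      Σ (Fin n → ℕ) (λ f → IndBroadcastDir (circulant1a n a) f × cost g ≤ cost f))
    × Σ (Fin n → ℕ) (λ f → IndBroadcastDir (circulant1a n a) f × diam (circulant1a n a) ≤ cost f)
proposition1 n a _ _ _ _ =
  (λ g g-indep → g , IndBroadcastUndir⇒IndBroadcastDir g-indep , ≤-refl) ,
  diam-indBroadcastDir (circulant1a n a)
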